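{- For every integer $n\ge 1$, $$I_n(q,t)=t\,I_{n-1}(q,t)+\sum_{k=0}^{n-2} q^{k+1}\, I_k(q,t)\, I_{n-k-1}(q,t).$$
   Context: For $n\ge 0$ let $\mathfrak S_n$ be the set of permutations of $[n]=\{1,\dots,n\}$, written in one-line notation $\sigma=b_1\ldots b_n$. A permutation $\sigma$ avoids $321$ if there are no indices $i<j<k$ with $b_i>b_j>b_k$; let $\mathrm{Av}_n(321)$ be the set of such $\sigma\in\mathfrak S_n$ (for $n=0$ it consists of the empty permutation). The inversion number is $\mathrm{inv}\,\sigma=\#\{(i,j): i<j,\ b_i>b_j\}$. An entry $b_i$ is a left-right maximum if $b_i=\max\{b_1,\dots,b_i\}$, and $\mathrm{lrm}\,\sigma$ denotes the number of left-right maxima of $\sigma$. Define $I_n(q,t)=\sum_{\sigma\in\mathrm{Av}_n(321)} q^{\mathrm{inv}\,\sigma}t^{\mathrm{lrm}\,\sigma}$, so $I_0(q,t)=1$. -}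

module Defs where

open import Level using (Level)
open import Data.Bool using (Bool; true; false; _∧_; _∨_; not)
open import Data.Nat using (ℕ; zero; suc; _<ᵇ_; _≡ᵇ_)
open import Data.Fin using (Fin; toℕ)
open import Data.List using (allFin)
open import Data.List using (List; []; _∷_; map; concatMap; filterᵇ; length)
open import Data.Bool.ListAction using (any)
open import Data.Vec using (Vec; []; _∷_; toList)
open import Algebra.Bundles using (CommutativeSemiring)

allVecs : {A : Set} → (m : ℕ) → List A → List (Vec A m)
allVecs zero    as = [] ∷ []
allVecs (suc m) as = concatMap (λ a → map (a ∷_) (allVecs m as)) as

-- One-line notation: a word b₁…bₙ with values in [n] = {1,…,n}
-- (a Fin n entry i stands for the value toℕ i + 1).
oneLine : {n : ℕ} → Vec (Fin n) n → List ℕ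
oneLine w = map (λ i → suc (toℕ i)) (toList w)

distinct : List ℕ → Bool
distinct []       = true
distinct (x ∷ xs) = not (any (λ y → x ≡ᵇ y) xs) ∧ distinct xs

-- A word of length n over [n] is a permutation iff its entries are distinct.
-- The permutations of [n], in one-line notation:
perms : ℕ → List (List ℕ)
perms n = filterᵇ distinct (map oneLine (allVecs n (allFin n)))

has21 : List ℕ → Bool
has21 []       = false
has21 (y ∷ ys) = any (λ z → z <ᵇ y) ys ∨ has21 ys

-- has321 w : there are i < j < k with b_i > b_j > b_k
-- (for the first letter x, look for a 21 pattern among the later letters smaller than x)
has321 : List ℕ → Bool
has321 []       = false
has321 (x ∷ xs) = has21 (filterᵇ (λ y → y <ᵇ x) xs) ∨ has321 xs

avoids321 : List ℕ → Bool
avoids321 w = not (has321 w)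

av321 : ℕ → List (List ℕ)
av321 n = filterᵇ avoids321 (perms n)

inv : List ℕ → ℕ
inv []       = 0
inv (x ∷ xs) = length (filterᵇ (λ y → y <ᵇ x) xs) + inv xs
  where open Data.Nat using (_+_)

-- number of left-right maxima; m is the maximum seen so far (0 initially, values are ≥ 1)
lrmFrom : ℕ → List ℕ → ℕ
lrmFrom m []       = 0
lrmFrom m (x ∷ xs) with m <ᵇ x
... | true  = suc (lrmFrom x xs)
... | false = lrmFrom m xs

lrm : List ℕ → ℕ
lrm = lrmFrom 0

module _ {c ℓ : Level} (R : CommutativeSemiring c ℓ) where
  open CommutativeSemiring R

  pow : Carrier → ℕ → Carrier
  pow x zero    = 1#
  pow x (suc k) = x * pow x k

  sumTo : ℕ → (ℕ → Carrier) → Carrier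
  sumTo zero    f = 0#
  sumTo (suc N) f = sumTo N f + f N

  sumList : List Carrier → Carrier
  sumList []       = 0#
  sumList (x ∷ xs) = x + sumList xs

  I : ℕ → Carrier → Carrier → Carrier
  I n q t = sumList (map (λ σ → pow q (inv σ) * pow t (lrm σ)) (av321 n))

module Submission where

-- A permutation avoids 321 iff, reading it from the left, every letter that
-- is not a new maximum is the least letter not yet used.  So the reading
-- proceeds through states (i, k), the numbers of unused letters below and
-- above the current maximum: the least letter below leads to (i-1, k) with
-- weight 1, the (j+1)-st letter above to (i+j, k-1-j) with weight q^(i+j) t.  Module
-- Recurrence solves the recursion with formal power series (Series): for
-- the sequence J defined by the claimed recurrence, F i = A (i+1) where
-- A (i+1) = A i + q^i A i(qx) (J - 1), so F 0 = A 1 = J.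

open import Defs
open import Level using (Level)
open import Data.Nat using (ℕ; suc; _≤_; _∸_)
open import Algebra.Bundles using (CommutativeSemiring)

open import Data.Nat.Base as Nat using (zero; _<_; _<ᵇ_; _≡ᵇ_; z≤n; s≤s)
import Data.Nat.Properties as ℕ
open import Data.Bool.Base using (Bool; true; false; T; not; _∧_; _∨_; if_then_else_)
open import Data.Bool.Properties using (T?; T-∨)
open import Function.Bundles using (Equivalence)
open import Data.Bool.ListAction using (any)
open import Data.Empty using (⊥-elim)
open import Data.Unit using (tt)
open import Data.Product using (_,_)
open import Data.Sum using (inj₁; inj₂)
open import Data.Fin using (Fin; toℕ)
import Data.Vec as Vec
open import Data.List.Base using (List; []; _∷_; _++_; map; concatMap; filterᵇ; length; allFin; tabulate)
open import Data.List.Properties using (filter-accept; filter-reject; filter-all; filter-none; map-∘; map-concatMap; concatMap-cong; concatMap-map; map-tabulate; length-tabulate)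
open import Data.List.Relation.Unary.All as All using (All; []; _∷_)
open import Data.List.Relation.Unary.All.Properties using (all-filter; tabulate⁺; ¬Any⇒All¬)
open import Data.List.Relation.Unary.Any using (here; there)
open import Data.List.Relation.Unary.Any.Properties using (any⁺; any⁻)
open import Data.List.Relation.Unary.AllPairs as AllPairs using (AllPairs; []; _∷_)
import Data.List.Relation.Unary.AllPairs.Properties as AllPairsₚ
open import Data.List.Relation.Unary.Unique.Propositional using (Unique)
open import Data.List.Membership.Propositional using (_∈_; lose; find)
open import Data.List.Membership.Propositional.Properties using (∈-map⁻; ∈-concatMap⁻; ∈-filter⁺)
open import Data.List.Relation.Binary.Permutation.Propositional using (_↭_; prep; swap; ↭-sym; ↭-trans; ↭-refl)
open import Data.List.Relation.Binary.Permutation.Propositional.Properties using (filter-↭; ↭-length; All-resp-↭; ∈-resp-↭)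
open import Data.List.Relation.Binary.Sublist.Propositional using (_⊆_; []; _∷ʳ_; _∷_; ⊆-refl)
open import Data.List.Relation.Binary.Sublist.Propositional.Properties using (Any-resp-⊆; filter⁺; filter-⊆)
open import Relation.Binary.PropositionalEquality as ≡ using (_≡_; _≢_)
open import Relation.Nullary using (¬_)
open import Function.Base using (_∘_)
open import Relation.Binary.Definitions using (tri<; tri≈; tri>)

module Letters where
  open ≡ using (refl; sym; trans; cong; subst; module ≡-Reasoning)

  ≢⇒T-not : ∀ {y z} → y ≢ z → T (not (y ≡ᵇ z))
  ≢⇒T-not {y} {z} y≢z with y ≡ᵇ z in eq
  ... | true  = ⊥-elim (y≢z (ℕ.≡ᵇ⇒≡ y z (subst T (sym eq) tt)))
  ... | false = tt

  T-not⇒≢ : ∀ {y z} → T (not (y ≡ᵇ z)) → y ≢ z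
  T-not⇒≢ {y} t refl with y ≡ᵇ y in eq
  ... | true  = t
  ... | false = subst T eq (ℕ.≡⇒≡ᵇ y y refl)

  ¬T⇒≡false : ∀ {b} → ¬ T b → b ≡ false
  ¬T⇒≡false {false} _ = refl
  ¬T⇒≡false {true}  f = ⊥-elim (f tt)

  T⇒≡true : ∀ {b} → T b → b ≡ true
  T⇒≡true {true} _ = refl

  ≮⇒¬T : ∀ {y z} → z ≤ y → ¬ T (y <ᵇ z)
  ≮⇒¬T {y} {z} z≤y t = ℕ.<⇒≱ (ℕ.<ᵇ⇒< y z t) z≤y

  below above : ℕ → List ℕ → List ℕ
  below a = filterᵇ (λ y → y <ᵇ a)
  above a = filterᵇ (λ y → a <ᵇ y)

  #below #above : ℕ → List ℕ → ℕ
  #below a xs = length (below a xs)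
  #above a xs = length (above a xs)

  #below-↭ : ∀ a {xs ys} → xs ↭ ys → #below a xs ≡ #below a ys
  #below-↭ a p = ↭-length (filter-↭ (T? ∘ (λ y → y <ᵇ a)) p)

  #above-↭ : ∀ a {xs ys} → xs ↭ ys → #above a xs ≡ #above a ys
  #above-↭ a p = ↭-length (filter-↭ (T? ∘ (λ y → a <ᵇ y)) p)

  #below-∷< : ∀ {a y} xs → y < a → #below a (y ∷ xs) ≡ suc (#below a xs)
  #below-∷< {a} {y} xs y<a = cong length (filter-accept (T? ∘ (λ z → z <ᵇ a)) {y} {xs} (ℕ.<⇒<ᵇ y<a))

  #below-∷≥ : ∀ {a y} xs → a ≤ y → #below a (y ∷ xs) ≡ #below a xs
  #below-∷≥ {a} {y} xs a≤y = cong length (filter-reject (T? ∘ (λ z → z <ᵇ a)) {y} {xs} (≮⇒¬T a≤y))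

  #above-∷> : ∀ {a y} xs → a < y → #above a (y ∷ xs) ≡ suc (#above a xs)
  #above-∷> {a} {y} xs a<y = cong length (filter-accept (T? ∘ (λ z → a <ᵇ z)) {y} {xs} (ℕ.<⇒<ᵇ a<y))

  #above-∷≤ : ∀ {a y} xs → y ≤ a → #above a (y ∷ xs) ≡ #above a xs
  #above-∷≤ {a} {y} xs y≤a = cong length (filter-reject (T? ∘ (λ z → a <ᵇ z)) {y} {xs} (≮⇒¬T y≤a))

  #below-min : ∀ {a xs} → All (a <_) xs → #below a xs ≡ 0
  #below-min {a} a<xs = cong length (filter-none (T? ∘ (λ z → z <ᵇ a)) (All.map (λ a<z → ≮⇒¬T (ℕ.<⇒≤ a<z)) a<xs))

  #above-min : ∀ {a xs} → All (a <_) xs → #above a xs ≡ length xs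
  #above-min {a} a<xs = cong length (filter-all (T? ∘ (λ z → a <ᵇ z)) (All.map ℕ.<⇒<ᵇ a<xs))

  _─_ : List ℕ → ℕ → List ℕ
  A ─ a = filterᵇ (λ y → not (a ≡ᵇ y)) A

  ─-excludes : ∀ a A → All (a ≢_) (A ─ a)
  ─-excludes a A = All.map T-not⇒≢ (all-filter (T? ∘ (λ y → not (a ≡ᵇ y))) A)

  ─-absent : ∀ {a A} → All (a ≢_) A → A ─ a ≡ A
  ─-absent a∉A = filter-all (T? ∘ _) (All.map ≢⇒T-not a∉A)

  not-self : ∀ a → ¬ T (not (a ≡ᵇ a))
  not-self a t = T-not⇒≢ {a} t refl

  ─-↭ : ∀ {a A} → Unique A → a ∈ A → A ↭ a ∷ (A ─ a)
  ─-↭ {a} {_ ∷ A} (a∉A ∷ _) (here refl)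
    rewrite filter-reject (T? ∘ (λ z → not (a ≡ᵇ z))) {a} {A} (not-self a) | ─-absent a∉A = ↭-refl
  ─-↭ {a} {y ∷ A} (y∉A ∷ uA) (there a∈A)
    rewrite filter-accept (T? ∘ (λ z → not (a ≡ᵇ z))) {y} {A} (≢⇒T-not (λ a≡y → All.lookup y∉A a∈A (sym a≡y)))
    = ↭-trans (prep y (─-↭ uA a∈A)) (swap y a ↭-refl)

  ─-preserves : ∀ {P : ℕ → ℕ → Set} a {A} → AllPairs P A → AllPairs P (A ─ a)
  ─-preserves a = AllPairsₚ.filter⁺ (T? ∘ (λ y → not (a ≡ᵇ y)))

  sorted⇒unique : ∀ {A} → AllPairs _<_ A → Unique A
  sorted⇒unique = AllPairs.map ℕ.<⇒≢

  #below-─ : ∀ {a A} → Unique A → a ∈ A → #below a (A ─ a) ≡ #below a A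
  #below-─ {a} {A} uA a∈A = sym (trans (#below-↭ a (─-↭ uA a∈A))
    (cong length (filter-reject (T? ∘ (λ y → y <ᵇ a)) {a} {A ─ a} (≮⇒¬T {a} ℕ.≤-refl))))

  #above-─ : ∀ {a A} → Unique A → a ∈ A → #above a (A ─ a) ≡ #above a A
  #above-─ {a} {A} uA a∈A = sym (trans (#above-↭ a (─-↭ uA a∈A))
    (cong length (filter-reject (T? ∘ (λ y → a <ᵇ y)) {a} {A ─ a} (≮⇒¬T {a} ℕ.≤-refl))))

  words : ℕ → List ℕ → List (List ℕ)
  words zero    A = [] ∷ []
  words (suc m) A = concatMap (λ a → map (a ∷_) (words m A)) A

  -- The arrangements of A: the words listing the letters of A, each once.
  -- The length m is fuel; it is meant to equal length A.
  arrangements : ℕ → List ℕ → List (List ℕ)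
  arrangements zero    A = [] ∷ []
  arrangements (suc m) A = concatMap (λ a → map (a ∷_) (arrangements m (A ─ a))) A

  ─-length : ∀ {a A m} → Unique A → a ∈ A → length A ≡ suc m → length (A ─ a) ≡ m
  ─-length uA a∈A len = ℕ.suc-injective (trans (sym (↭-length (─-↭ uA a∈A))) len)

  arrangement-↭ : ∀ m {A w} → Unique A → length A ≡ m → w ∈ arrangements m A → w ↭ A
  arrangement-↭ zero    {[]} _ _ (here refl) = ↭-refl
  arrangement-↭ (suc m) {A} uA len w∈
    with a , a∈A , w∈a ← find (∈-concatMap⁻ (λ a → map (a ∷_) (arrangements m (A ─ a))) {xs = A} w∈)
    with w′ , w′∈ , refl ← ∈-map⁻ (a ∷_) w∈a
    = ↭-trans (prep a (arrangement-↭ m (─-preserves a uA) (─-length uA a∈A len) w′∈)) (↭-sym (─-↭ uA a∈A))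

  letter : ∀ {n} → Fin n → ℕ
  letter i = suc (toℕ i)

  alphabet : ℕ → List ℕ
  alphabet n = map letter (allFin n)

  readLetters : ∀ {n m} → Vec.Vec (Fin n) m → List ℕ
  readLetters v = map letter (Vec.toList v)

  oneLine-words : ∀ {n} m (As : List (Fin n)) → map readLetters (allVecs m As) ≡ words m (map letter As)
  oneLine-words zero    As = refl
  oneLine-words (suc m) As = begin
    map readLetters (concatMap (λ a → map (a Vec.∷_) (allVecs m As)) As)
      ≡⟨ map-concatMap readLetters _ As ⟩
    concatMap (λ a → map readLetters (map (a Vec.∷_) (allVecs m As))) As
      ≡⟨ concatMap-cong (λ a → trans (sym (map-∘ (allVecs m As))) (map-∘ (allVecs m As))) As ⟩
    concatMap (λ a → map (letter a ∷_) (map readLetters (allVecs m As))) As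
      ≡⟨ cong (λ ws → concatMap (λ a → map (letter a ∷_) ws) As) (oneLine-words m As) ⟩
    concatMap (λ a → map (letter a ∷_) (words m (map letter As))) As
      ≡⟨ sym (concatMap-map (λ b → map (b ∷_) (words m (map letter As))) letter As) ⟩
    concatMap (λ b → map (b ∷_) (words m (map letter As))) (map letter As) ∎
    where open ≡-Reasoning

  alphabet-tabulate : ∀ n → alphabet n ≡ tabulate letter
  alphabet-tabulate n = map-tabulate (λ i → i) letter

  alphabet-length : ∀ n → length (alphabet n) ≡ n
  alphabet-length n = trans (cong length (alphabet-tabulate n)) (length-tabulate letter)

  alphabet-positive : ∀ n → All (0 <_) (alphabet n)
  alphabet-positive n rewrite alphabet-tabulate n = tabulate⁺ (λ i → s≤s z≤n)

  alphabet-sorted : ∀ n → AllPairs _<_ (alphabet n)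
  alphabet-sorted n rewrite alphabet-tabulate n = AllPairsₚ.tabulate⁺-< s≤s

  any-⊆ : ∀ (p : ℕ → Bool) {xs ys} → xs ⊆ ys → T (any p xs) → T (any p ys)
  any-⊆ p {xs} xs⊆ys t = any⁺ p (Any-resp-⊆ xs⊆ys (any⁻ p xs t))

  has21-⊆ : ∀ {xs ys} → xs ⊆ ys → T (has21 xs) → T (has21 ys)
  has21-⊆ (y ∷ʳ xs⊆ys) t = Equivalence.from T-∨ (inj₂ (has21-⊆ xs⊆ys t))
  has21-⊆ (refl ∷ xs⊆ys) t with Equivalence.to T-∨ t
  ... | inj₁ smaller = Equivalence.from T-∨ (inj₁ (any-⊆ _ xs⊆ys smaller))
  ... | inj₂ later = Equivalence.from T-∨ (inj₂ (has21-⊆ xs⊆ys later))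

  below-⊆ : ∀ {M a} → M ≤ a → (w : List ℕ) → below M w ⊆ below a w
  below-⊆ {M} {a} M≤a w = filter⁺ (T? ∘ (λ y → y <ᵇ M)) (T? ∘ (λ y → y <ᵇ a))
    (λ { {y} refl t → ℕ.<⇒<ᵇ (ℕ.<-≤-trans (ℕ.<ᵇ⇒< y M t) M≤a) }) (⊆-refl {x = w})

  any-below : ∀ {a M} → a ≤ M → (w : List ℕ) → T (any (λ y → y <ᵇ a) w) → T (any (λ y → y <ᵇ a) (below M w))
  any-below {a} {M} a≤M w t with z , z∈w , z<a ← find (any⁻ (λ y → y <ᵇ a) w t)
    = any⁺ (λ y → y <ᵇ a) (lose (∈-filter⁺ (T? ∘ (λ y → y <ᵇ M)) z∈w
        (ℕ.<⇒<ᵇ (ℕ.<-≤-trans (ℕ.<ᵇ⇒< z a z<a) a≤M))) z<a)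

  below-empty : ∀ a w → ¬ T (any (λ y → y <ᵇ a) w) → below a w ≡ []
  below-empty a w none = filter-none (T? ∘ (λ y → y <ᵇ a)) (¬Any⇒All¬ w (none ∘ any⁺ (λ y → y <ᵇ a)))

module Sums {c ℓ : Level} (R : CommutativeSemiring c ℓ) where
  open CommutativeSemiring R hiding (zero)

  sumOver : {A : Set} → (A → Carrier) → List A → Carrier
  sumOver f []       = 0#
  sumOver f (x ∷ xs) = f x + sumOver f xs

  sumList-map : {A : Set} (f : A → Carrier) (xs : List A) → sumList R (map f xs) ≡ sumOver f xs
  sumList-map f []       = ≡.refl
  sumList-map f (x ∷ xs) = ≡.cong (f x +_) (sumList-map f xs)

  sumOver-cong : {A : Set} {f g : A → Carrier} (xs : List A) → (∀ x → x ∈ xs → f x ≈ g x) →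
    sumOver f xs ≈ sumOver g xs
  sumOver-cong []       f≈g = refl
  sumOver-cong (x ∷ xs) f≈g = +-cong (f≈g x (here ≡.refl)) (sumOver-cong xs (λ y y∈ → f≈g y (there y∈)))

  sumOver-zero : {A : Set} (f : A → Carrier) (xs : List A) → (∀ x → x ∈ xs → f x ≈ 0#) → sumOver f xs ≈ 0#
  sumOver-zero f []       f≈0 = refl
  sumOver-zero f (x ∷ xs) f≈0 =
    trans (+-cong (f≈0 x (here ≡.refl)) (sumOver-zero f xs (λ y y∈ → f≈0 y (there y∈)))) (+-identityˡ 0#)

  sumOver-*ˡ : {A : Set} (k : Carrier) (f : A → Carrier) (xs : List A) →
    sumOver (λ x → k * f x) xs ≈ k * sumOver f xs
  sumOver-*ˡ k f []       = sym (zeroʳ k)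
  sumOver-*ˡ k f (x ∷ xs) = trans (+-cong refl (sumOver-*ˡ k f xs)) (sym (distribˡ k _ _))

  sumOver-++ : {A : Set} (f : A → Carrier) (xs ys : List A) → sumOver f (xs ++ ys) ≈ sumOver f xs + sumOver f ys
  sumOver-++ f []       ys = sym (+-identityˡ _)
  sumOver-++ f (x ∷ xs) ys = trans (+-cong refl (sumOver-++ f xs ys)) (sym (+-assoc _ _ _))

  sumOver-prefixes : (f : List ℕ → Carrier) (ws : ℕ → List (List ℕ)) (as : List ℕ) →
    sumOver f (concatMap (λ a → map (a ∷_) (ws a)) as) ≈ sumOver (λ a → sumOver (λ w → f (a ∷ w)) (ws a)) as
  sumOver-prefixes f ws []       = refl
  sumOver-prefixes f ws (a ∷ as) = trans (sumOver-++ f (map (a ∷_) (ws a)) _)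
    (+-cong (reflexive (sumOver-map (ws a))) (sumOver-prefixes f ws as))
    where
    sumOver-map : (vs : List (List ℕ)) → sumOver f (map (a ∷_) vs) ≡ sumOver (λ w → f (a ∷ w)) vs
    sumOver-map []       = ≡.refl
    sumOver-map (v ∷ vs) = ≡.cong (f (a ∷ v) +_) (sumOver-map vs)

  when : Bool → Carrier → Carrier
  when b x = if b then x else 0#

  when-cong : ∀ b {x y} → x ≈ y → when b x ≈ when b y
  when-cong true  x≈y = x≈y
  when-cong false x≈y = refl

  when-zero : ∀ b → when b 0# ≈ 0#
  when-zero true  = refl
  when-zero false = refl

  when-*ˡ : ∀ b k x → when b (k * x) ≈ k * when b x
  when-*ˡ true  k x = refl
  when-*ˡ false k x = sym (zeroʳ k)

  when-∧ : ∀ b b′ x → when (b ∧ b′) x ≡ when b (when b′ x)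
  when-∧ true  b′ x = ≡.refl
  when-∧ false b′ x = ≡.refl

  when-not-∨ : ∀ b b′ x → when (not (b ∨ b′)) x ≡ when (not b) (when (not b′) x)
  when-not-∨ true  b′ x = ≡.refl
  when-not-∨ false b′ x = ≡.refl

  when-comm : ∀ b b′ x → when b (when b′ x) ≡ when b′ (when b x)
  when-comm true  b′    x = ≡.refl
  when-comm false true  x = ≡.refl
  when-comm false false x = ≡.refl

  when-implied : ∀ b b′ b″ → (T b′ → T b) → ∀ x →
    when (not b) (when b″ (when (not b′) x)) ≡ when (not b) (when b″ x)
  when-implied true  b′    b″ _    x = ≡.refl
  when-implied false false b″ _    x = ≡.refl
  when-implied false true  b″ b′⇒b x = ⊥-elim (b′⇒b tt)

  sumOver-filter : {A : Set} (f : A → Carrier) (p : A → Bool) (xs : List A) →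
    sumOver f (filterᵇ p xs) ≈ sumOver (λ x → when (p x) (f x)) xs
  sumOver-filter f p []       = refl
  sumOver-filter f p (x ∷ xs) with p x
  ... | true  = +-cong refl (sumOver-filter f p xs)
  ... | false = trans (sumOver-filter f p xs) (sym (+-identityˡ _))

  sumOver-when : {A : Set} (b : Bool) (f : A → Carrier) (xs : List A) →
    sumOver (λ x → when b (f x)) xs ≈ when b (sumOver f xs)
  sumOver-when true  f xs = refl
  sumOver-when false f xs = sumOver-zero (λ _ → 0#) xs (λ _ _ → refl)

module WordSums {c ℓ : Level} (R : CommutativeSemiring c ℓ) where
  open CommutativeSemiring R hiding (zero)
  open import Relation.Binary.Reasoning.Setoid setoid
  open Letters
  open Sums R

  sumOver-avoiding : ∀ m A a (h : List ℕ → Carrier) →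
    sumOver (λ w → when (not (any (λ y → a ≡ᵇ y) w)) (h w)) (words m A) ≈ sumOver h (words m (A ─ a))
  sumOver-avoiding zero    A a h = refl
  sumOver-avoiding (suc m) A a h = begin
    sumOver (λ w → when (not (any (a ≡ᵇ_) w)) (h w)) (words (suc m) A)
      ≈⟨ sumOver-prefixes _ (λ _ → words m A) A ⟩
    sumOver (λ b → sumOver (λ w → when (not ((a ≡ᵇ b) ∨ any (a ≡ᵇ_) w)) (h (b ∷ w))) (words m A)) A
      ≈⟨ sumOver-cong A (λ b _ → begin
           sumOver (λ w → when (not ((a ≡ᵇ b) ∨ any (a ≡ᵇ_) w)) (h (b ∷ w))) (words m A)
             ≈⟨ sumOver-cong (words m A) (λ w _ → reflexive (when-not-∨ (a ≡ᵇ b) _ _)) ⟩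
           sumOver (λ w → when (not (a ≡ᵇ b)) (when (not (any (a ≡ᵇ_) w)) (h (b ∷ w)))) (words m A)
             ≈⟨ sumOver-when (not (a ≡ᵇ b)) _ (words m A) ⟩
           when (not (a ≡ᵇ b)) (sumOver (λ w → when (not (any (a ≡ᵇ_) w)) (h (b ∷ w))) (words m A))
             ≈⟨ when-cong (not (a ≡ᵇ b)) (sumOver-avoiding m A a (h ∘ (b ∷_))) ⟩
           when (not (a ≡ᵇ b)) (sumOver (λ w → h (b ∷ w)) (words m (A ─ a))) ∎) ⟩
    sumOver (λ b → when (not (a ≡ᵇ b)) (sumOver (λ w → h (b ∷ w)) (words m (A ─ a)))) A
      ≈⟨ sumOver-filter _ (λ b → not (a ≡ᵇ b)) A ⟨
    sumOver (λ b → sumOver (λ w → h (b ∷ w)) (words m (A ─ a))) (A ─ a)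
      ≈⟨ sumOver-prefixes h (λ _ → words m (A ─ a)) (A ─ a) ⟨
    sumOver h (words (suc m) (A ─ a)) ∎

  sumOver-distinct : ∀ m A (h : List ℕ → Carrier) →
    sumOver (λ w → when (distinct w) (h w)) (words m A) ≈ sumOver h (arrangements m A)
  sumOver-distinct zero    A h = refl
  sumOver-distinct (suc m) A h = begin
    sumOver (λ w → when (distinct w) (h w)) (words (suc m) A)
      ≈⟨ sumOver-prefixes _ (λ _ → words m A) A ⟩
    sumOver (λ b → sumOver (λ w → when (not (any (b ≡ᵇ_) w) ∧ distinct w) (h (b ∷ w))) (words m A)) A
      ≈⟨ sumOver-cong A (λ b _ → begin
           sumOver (λ w → when (not (any (b ≡ᵇ_) w) ∧ distinct w) (h (b ∷ w))) (words m A)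
             ≈⟨ sumOver-cong (words m A) (λ w _ → reflexive (when-∧ (not (any (b ≡ᵇ_) w)) _ _)) ⟩
           sumOver (λ w → when (not (any (b ≡ᵇ_) w)) (when (distinct w) (h (b ∷ w)))) (words m A)
             ≈⟨ sumOver-avoiding m A b _ ⟩
           sumOver (λ w → when (distinct w) (h (b ∷ w))) (words m (A ─ b))
             ≈⟨ sumOver-distinct m (A ─ b) (h ∘ (b ∷_)) ⟩
           sumOver (λ w → h (b ∷ w)) (arrangements m (A ─ b)) ∎) ⟩
    sumOver (λ b → sumOver (λ w → h (b ∷ w)) (arrangements m (A ─ b))) A
      ≈⟨ sumOver-prefixes h (λ b → arrangements m (A ─ b)) A ⟨
    sumOver h (arrangements (suc m) A) ∎

  sumOver-av321 : (g : List ℕ → Carrier) (n : ℕ) →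
    sumList R (map g (av321 n)) ≈ sumOver (λ w → when (avoids321 w) (g w)) (arrangements n (alphabet n))
  sumOver-av321 g n = begin
    sumList R (map g (av321 n))
      ≡⟨ sumList-map g (av321 n) ⟩
    sumOver g (filterᵇ avoids321 (filterᵇ distinct (map oneLine (allVecs n (allFin n)))))
      ≈⟨ sumOver-filter g avoids321 (filterᵇ distinct (map oneLine (allVecs n (allFin n)))) ⟩
    sumOver (λ w → when (avoids321 w) (g w)) (filterᵇ distinct (map oneLine (allVecs n (allFin n))))
      ≈⟨ sumOver-filter _ distinct (map oneLine (allVecs n (allFin n))) ⟩
    sumOver (λ w → when (distinct w) (when (avoids321 w) (g w))) (map oneLine (allVecs n (allFin n)))
      ≡⟨ ≡.cong (sumOver _) (oneLine-words n (allFin n)) ⟩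
    sumOver (λ w → when (distinct w) (when (avoids321 w) (g w))) (words n (alphabet n))
      ≈⟨ sumOver-distinct n (alphabet n) _ ⟩
    sumOver (λ w → when (avoids321 w) (g w)) (arrangements n (alphabet n)) ∎

module Scan {c ℓ : Level} (R : CommutativeSemiring c ℓ) (q t : CommutativeSemiring.Carrier R) where
  open CommutativeSemiring R hiding (zero)
  open import Relation.Binary.Reasoning.Setoid setoid
  open import Algebra.Properties.CommutativeSemigroup
    *-commutativeSemigroup using (interchange)
  open Letters
  open Sums R
  open WordSums R using (sumOver-av321)

  pow-+ : ∀ x m n → pow R x (m Nat.+ n) ≈ pow R x m * pow R x n
  pow-+ x zero    n = sym (*-identityˡ _)
  pow-+ x (suc m) n = trans (*-cong refl (pow-+ x m n)) (sym (*-assoc _ _ _))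

  weight : ℕ → List ℕ → Carrier
  weight M w = pow R q (inv w) * pow R t (lrmFrom M w)

  -- The weight of w as the continuation of a 321-avoiding permutation whose
  -- prefix has largest letter M: w must avoid 321 and its letters below M
  -- must increase, for otherwise M would head a 321 pattern.
  Φ : ℕ → List ℕ → Carrier
  Φ M w = when (avoids321 w) (when (not (has21 (below M w))) (weight M w))

  lrm-new-max : ∀ {M a} w → M < a → lrmFrom M (a ∷ w) ≡ suc (lrmFrom a w)
  lrm-new-max {M} {a} w M<a rewrite T⇒≡true (ℕ.<⇒<ᵇ M<a) = ≡.refl

  lrm-below-max : ∀ {M a} w → a < M → lrmFrom M (a ∷ w) ≡ lrmFrom M w
  lrm-below-max {M} {a} w a<M rewrite ¬T⇒≡false (≮⇒¬T {M} {a} (ℕ.<⇒≤ a<M)) = ≡.refl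

  -- A new maximum a is a left-right maximum and is inverted with exactly
  -- the later letters below it.
  peel-new-max : ∀ {M a} w → M < a → Φ M (a ∷ w) ≈ pow R q (#below a w) * t * Φ a w
  peel-new-max {M} {a} w M<a = begin
    Φ M (a ∷ w)
      ≡⟨ when-not-∨ (has21 (below a w)) (has321 w) _ ⟩
    when (not (has21 (below a w))) (when (avoids321 w)
      (when (not (has21 (below M (a ∷ w)))) (pow R q (#below a w Nat.+ inv w) * pow R t (lrmFrom M (a ∷ w)))))
      ≡⟨ ≡.cong₂ (λ v l → when (not (has21 (below a w))) (when (avoids321 w)
                            (when (not (has21 v)) (pow R q (#below a w Nat.+ inv w) * pow R t l))))
           (filter-reject (T? ∘ (λ y → y <ᵇ M)) (≮⇒¬T (ℕ.<⇒≤ M<a))) (lrm-new-max w M<a) ⟩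
    when (not (has21 (below a w))) (when (avoids321 w)
      (when (not (has21 (below M w))) (pow R q (#below a w Nat.+ inv w) * (t * pow R t (lrmFrom a w)))))
      ≡⟨ when-implied (has21 (below a w)) (has21 (below M w)) (avoids321 w)
           (has21-⊆ (below-⊆ (ℕ.<⇒≤ M<a) w)) _ ⟩
    when (not (has21 (below a w))) (when (avoids321 w)
      (pow R q (#below a w Nat.+ inv w) * (t * pow R t (lrmFrom a w))))
      ≈⟨ when-cong (not (has21 (below a w))) (when-cong (avoids321 w)
           (trans (*-cong (pow-+ q (#below a w) (inv w)) refl) (interchange _ _ _ _))) ⟩
    when (not (has21 (below a w))) (when (avoids321 w) (pow R q (#below a w) * t * weight a w))
      ≈⟨ when-cong (not (has21 (below a w))) (when-*ˡ (avoids321 w) _ _) ⟩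
    when (not (has21 (below a w))) (pow R q (#below a w) * t * when (avoids321 w) (weight a w))
      ≈⟨ when-*ˡ (not (has21 (below a w))) _ _ ⟩
    pow R q (#below a w) * t * when (not (has21 (below a w))) (when (avoids321 w) (weight a w))
      ≡⟨ ≡.cong (pow R q (#below a w) * t *_) (when-comm (not (has21 (below a w))) (avoids321 w) _) ⟩
    pow R q (#below a w) * t * Φ a w ∎

  peel-below-max : ∀ {M a} w → a < M → Φ M (a ∷ w) ≈ when (not (any (λ y → y <ᵇ a) w)) (Φ M w)
  peel-below-max {M} {a} w a<M with any (λ y → y <ᵇ a) w in smaller
  ... | true = begin
    Φ M (a ∷ w)
      ≡⟨ ≡.cong (λ v → when (not (has21 (below a w) ∨ has321 w)) (when (not (has21 v)) (weight M (a ∷ w))))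
           (filter-accept (T? ∘ (λ y → y <ᵇ M)) (ℕ.<⇒<ᵇ a<M)) ⟩
    when (not (has21 (below a w) ∨ has321 w)) (when (not (smaller-below-M ∨ has21 (below M w))) (weight M (a ∷ w)))
      ≡⟨ ≡.cong (λ b → when (not (has21 (below a w) ∨ has321 w)) (when (not (b ∨ has21 (below M w))) (weight M (a ∷ w))))
           (T⇒≡true (any-below (ℕ.<⇒≤ a<M) w (≡.subst T (≡.sym smaller) tt))) ⟩
    when (not (has21 (below a w) ∨ has321 w)) 0#
      ≈⟨ when-zero _ ⟩
    0# ∎
    where
    smaller-below-M : Bool
    smaller-below-M = any (λ y → y <ᵇ a) (below M w)
  ... | false = begin
    Φ M (a ∷ w)
      ≡⟨ ≡.cong₂ (λ v u → when (not (has21 v ∨ has321 w)) (when (not (has21 u)) (pow R q (length v Nat.+ inv w) * lrm-weight)))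
           (below-empty a w (≡.subst T smaller))
           (filter-accept (T? ∘ (λ y → y <ᵇ M)) (ℕ.<⇒<ᵇ a<M)) ⟩
    when (avoids321 w) (when (not (smaller-below-M ∨ has21 (below M w))) (pow R q (inv w) * lrm-weight))
      ≡⟨ ≡.cong₂ (λ b l → when (avoids321 w) (when (not (b ∨ has21 (below M w))) (pow R q (inv w) * pow R t l)))
           (¬T⇒≡false (≡.subst T smaller ∘ any-⊆ (λ y → y <ᵇ a) (filter-⊆ (T? ∘ (λ y → y <ᵇ M)) w)))
           (lrm-below-max w a<M) ⟩
    Φ M w ∎
    where
    smaller-below-M : Bool
    smaller-below-M = any (λ y → y <ᵇ a) (below M w)
    lrm-weight : Carrier
    lrm-weight = pow R t (lrmFrom M (a ∷ w))

  -- F i k is the scan sum over the arrangements of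
  -- an alphabet with i letters below the current maximum and k above it, and
  -- U i k is its part where the next letter is a new maximum.  The next letter
  -- is either the least letter below the maximum, leading to (i - 1, k), or
  -- the (j+1)-st letter above it, which has weight q^(i+j) t and leads to
  -- (i + j, k - 1 - j).
  F U : ℕ → ℕ → Carrier
  F zero    zero    = 1#
  F zero    (suc k) = U zero (suc k)
  F (suc i) k       = F i k + U (suc i) k
  U i zero    = 0#
  U i (suc k) = pow R q i * t * F i k + U (suc i) k

  -- The contribution of the letter a of A when it is read as a new maximum
  -- above M, in the presence of s further letters below it.
  newMaxTerm : ℕ → List ℕ → ℕ → ℕ → Carrier
  newMaxTerm M A s a = when (M <ᵇ a) (pow R q (s Nat.+ #below a A) * t * F (s Nat.+ #below a A) (#above a A))

  newMaxTerm-above : ∀ {M a} A s → M < a →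
    newMaxTerm M A s a ≡ pow R q (s Nat.+ #below a A) * t * F (s Nat.+ #below a A) (#above a A)
  newMaxTerm-above A s M<a rewrite T⇒≡true (ℕ.<⇒<ᵇ M<a) = ≡.refl

  newMaxTerm-below : ∀ {M a} A s → a < M → newMaxTerm M A s a ≡ 0#
  newMaxTerm-below {M} {a} A s a<M rewrite ¬T⇒≡false (≮⇒¬T {M} {a} (ℕ.<⇒≤ a<M)) = ≡.refl

  -- Removing the least letter y of an alphabet: the letters above y see one
  -- fewer letter below them.
  newMaxTerm-tail : ∀ M {y A} s → All (y <_) A → sumOver (newMaxTerm M (y ∷ A) s) A ≈ sumOver (newMaxTerm M A (suc s)) A
  newMaxTerm-tail M {y} {A} s y<A = sumOver-cong A (λ a a∈A → reflexive (≡.cong₂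
    (λ i k → when (M <ᵇ a) (pow R q i * t * F i k))
    (≡.trans (≡.cong (s Nat.+_) (#below-∷< A (All.lookup y<A a∈A))) (ℕ.+-suc s _))
    (#above-∷≤ A (ℕ.<⇒≤ (All.lookup y<A a∈A)))))

  sum-new-max : ∀ {M} s A → AllPairs _<_ A → All (M ≢_) A →
    sumOver (newMaxTerm M A s) A ≈ U (s Nat.+ #below M A) (#above M A)
  sum-new-max s [] [] [] = refl
  sum-new-max {M} s (y ∷ A) (y<A ∷ sA) (M≢y ∷ M∉A) with ℕ.<-cmp M y
  ... | tri≈ _ M≡y _ = ⊥-elim (M≢y M≡y)
  ... | tri> _ _ y<M = begin
    newMaxTerm M (y ∷ A) s y + sumOver (newMaxTerm M (y ∷ A) s) A
      ≡⟨ ≡.cong (_+ sumOver (newMaxTerm M (y ∷ A) s) A) (newMaxTerm-below (y ∷ A) s y<M) ⟩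
    0# + sumOver (newMaxTerm M (y ∷ A) s) A
      ≈⟨ +-identityˡ _ ⟩
    sumOver (newMaxTerm M (y ∷ A) s) A
      ≈⟨ newMaxTerm-tail M s y<A ⟩
    sumOver (newMaxTerm M A (suc s)) A
      ≈⟨ sum-new-max (suc s) A sA M∉A ⟩
    U (suc s Nat.+ #below M A) (#above M A)
      ≡⟨ ≡.cong₂ U (≡.trans (≡.sym (ℕ.+-suc s _)) (≡.cong (s Nat.+_) (≡.sym (#below-∷< A y<M))))
                   (≡.sym (#above-∷≤ A (ℕ.<⇒≤ y<M))) ⟩
    U (s Nat.+ #below M (y ∷ A)) (#above M (y ∷ A)) ∎
  ... | tri< M<y _ _ = begin
    newMaxTerm M (y ∷ A) s y + sumOver (newMaxTerm M (y ∷ A) s) A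
      ≡⟨ ≡.cong (_+ sumOver (newMaxTerm M (y ∷ A) s) A) (≡.trans (newMaxTerm-above (y ∷ A) s M<y)
           (≡.cong₂ (λ i k → pow R q (s Nat.+ i) * t * F (s Nat.+ i) k)
              (≡.trans (#below-∷≥ {y} A ℕ.≤-refl) (#below-min y<A))
              (≡.trans (#above-∷≤ {y} A ℕ.≤-refl) (#above-min y<A)))) ⟩
    pow R q (s Nat.+ 0) * t * F (s Nat.+ 0) (length A) + sumOver (newMaxTerm M (y ∷ A) s) A
      ≈⟨ +-cong refl (trans (newMaxTerm-tail M s y<A) (sum-new-max (suc s) A sA M∉A)) ⟩
    pow R q (s Nat.+ 0) * t * F (s Nat.+ 0) (length A) + U (suc s Nat.+ #below M A) (#above M A)
      ≡⟨ ≡.cong₂ (λ i k → pow R q (s Nat.+ 0) * t * F (s Nat.+ 0) (length A) + U (suc s Nat.+ i) k)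
           (#below-min M<A) (#above-min M<A) ⟩
    U (s Nat.+ 0) (suc (length A))
      ≡⟨ ≡.cong₂ (λ i k → U (s Nat.+ i) k)
           (≡.sym (≡.trans (#below-∷≥ A (ℕ.<⇒≤ M<y)) (#below-min M<A)))
           (≡.sym (≡.trans (#above-∷> A M<y) (≡.cong suc (#above-min M<A)))) ⟩
    U (s Nat.+ #below M (y ∷ A)) (#above M (y ∷ A)) ∎
    where
    M<A : All (M <_) A
    M<A = All.map (ℕ.<-trans M<y) y<A

  leading : ℕ → ℕ → List ℕ → ℕ → Carrier
  leading M m A a = sumOver (λ w → Φ M (a ∷ w)) (arrangements m (A ─ a))

  leading-not-least : ∀ m {A M x a} → length A ≡ suc m → Unique A → x ∈ A → x < a → a < M → a ∈ A →
    leading M m A a ≈ 0#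
  leading-not-least m {A} {M} {x} {a} len uA x∈A x<a a<M a∈A =
    sumOver-zero _ (arrangements m (A ─ a)) λ w w∈ → begin
      Φ M (a ∷ w)
        ≈⟨ peel-below-max w a<M ⟩
      when (not (any (λ y → y <ᵇ a) w)) (Φ M w)
        ≡⟨ ≡.cong (λ b → when (not b) (Φ M w))
             (T⇒≡true (any⁺ (λ y → y <ᵇ a) (lose (x∈w w∈) (ℕ.<⇒<ᵇ x<a)))) ⟩
      0# ∎
    where
    x∈w : ∀ {w} → w ∈ arrangements m (A ─ a) → x ∈ w
    x∈w w∈ = ∈-resp-↭ (↭-sym (arrangement-↭ m (─-preserves a uA) (─-length uA a∈A len) w∈))
               (∈-filter⁺ (T? ∘ (λ y → not (a ≡ᵇ y))) x∈A (≢⇒T-not (λ a≡x → ℕ.<⇒≢ x<a (≡.sym a≡x))))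

  scan : ∀ m {A M} → length A ≡ m → AllPairs _<_ A → All (M ≢_) A →
    sumOver (Φ M) (arrangements m A) ≈ F (#below M A) (#above M A)

  -- A new maximum a comes next: the rest is scanned with maximum a.
  leading-new-max : ∀ m {A M a} → length A ≡ suc m → AllPairs _<_ A → a ∈ A → M < a →
    leading M m A a ≈ pow R q (#below a A) * t * F (#below a A) (#above a A)
  leading-new-max m {A} {M} {a} len sA a∈A M<a = begin
    sumOver (λ w → Φ M (a ∷ w)) (arrangements m (A ─ a))
      ≈⟨ sumOver-cong _ (λ w w∈ → trans (peel-new-max w M<a)
           (*-cong (*-cong (reflexive (≡.cong (pow R q) (#below-arrangement w∈))) refl) refl)) ⟩
    sumOver (λ w → pow R q (#below a A) * t * Φ a w) (arrangements m (A ─ a))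
      ≈⟨ sumOver-*ˡ (pow R q (#below a A) * t) (Φ a) (arrangements m (A ─ a)) ⟩
    pow R q (#below a A) * t * sumOver (Φ a) (arrangements m (A ─ a))
      ≈⟨ *-cong refl (scan m (─-length uA a∈A len) (─-preserves a sA) (─-excludes a A)) ⟩
    pow R q (#below a A) * t * F (#below a (A ─ a)) (#above a (A ─ a))
      ≡⟨ ≡.cong₂ (λ i k → pow R q (#below a A) * t * F i k) (#below-─ uA a∈A) (#above-─ uA a∈A) ⟩
    pow R q (#below a A) * t * F (#below a A) (#above a A) ∎
    where
    uA : Unique A
    uA = sorted⇒unique sA
    #below-arrangement : ∀ {w} → w ∈ arrangements m (A ─ a) → #below a w ≡ #below a A
    #below-arrangement w∈ = ≡.trans (#below-↭ a (arrangement-↭ m (─-preserves a uA) (─-length uA a∈A len) w∈))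
                                    (#below-─ uA a∈A)

  leading-above-least : ∀ m {A M x a} → length A ≡ suc m → AllPairs _<_ A → All (M ≢_) A →
    x ∈ A → x < a → a ∈ A → leading M m A a ≈ newMaxTerm M A 0 a
  leading-above-least m {A} {M} {x} {a} len sA M∉A x∈A x<a a∈A with ℕ.<-cmp M a
  ... | tri≈ _ M≡a _ = ⊥-elim (All.lookup M∉A a∈A M≡a)
  ... | tri< M<a _ _ = trans (leading-new-max m len sA a∈A M<a) (reflexive (≡.sym (newMaxTerm-above A 0 M<a)))
  ... | tri> _ _ a<M = trans (leading-not-least m len (sorted⇒unique sA) x∈A x<a a<M a∈A)
                         (reflexive (≡.sym (newMaxTerm-below A 0 a<M)))

  leading-least : ∀ m {A M x} → length A ≡ m → AllPairs _<_ A → All (M ≢_) A → All (x <_) A → x < M →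
    leading M m (x ∷ A) x ≈ F (#below M A) (#above M A)
  leading-least m {A} {M} {x} len sA M∉A x<A x<M = begin
    sumOver (λ w → Φ M (x ∷ w)) (arrangements m ((x ∷ A) ─ x))
      ≡⟨ ≡.cong (λ B → sumOver (λ w → Φ M (x ∷ w)) (arrangements m B))
           (≡.trans (filter-reject (T? ∘ (λ y → not (x ≡ᵇ y))) (not-self x)) (─-absent (All.map ℕ.<⇒≢ x<A))) ⟩
    sumOver (λ w → Φ M (x ∷ w)) (arrangements m A)
      ≈⟨ sumOver-cong _ (λ w w∈ → trans (peel-below-max w x<M)
           (reflexive (≡.cong (λ b → when (not b) (Φ M w)) (¬T⇒≡false (nothing-below w∈))))) ⟩
    sumOver (Φ M) (arrangements m A)
      ≈⟨ scan m len sA M∉A ⟩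
    F (#below M A) (#above M A) ∎
    where
    nothing-below : ∀ {w} → w ∈ arrangements m A → ¬ T (any (λ y → y <ᵇ x) w)
    nothing-below {w} w∈ below-x with y , y∈w , y<x ← find (any⁻ (λ y → y <ᵇ x) w below-x) =
      ℕ.<⇒≱ (ℕ.<ᵇ⇒< y x y<x)
        (ℕ.<⇒≤ (All.lookup (All-resp-↭ (↭-sym (arrangement-↭ m (sorted⇒unique sA) len w∈)) x<A) y∈w))

  scan zero {[]} _ _ _ = trans (+-identityʳ _) (*-identityˡ 1#)
  scan (suc m) {x ∷ A} {M} len (x<A ∷ sA) (M≢x ∷ M∉A) with ℕ.<-cmp M x
  ... | tri≈ _ M≡x _ = ⊥-elim (M≢x M≡x)
  ... | tri> _ _ x<M = begin
    sumOver (Φ M) (arrangements (suc m) (x ∷ A))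
      ≈⟨ sumOver-prefixes (Φ M) (λ a → arrangements m ((x ∷ A) ─ a)) (x ∷ A) ⟩
    leading M m (x ∷ A) x + sumOver (leading M m (x ∷ A)) A
      ≈⟨ +-cong (leading-least m (ℕ.suc-injective len) sA M∉A x<A x<M) rest-above-x ⟩
    F (#below M A) (#above M A) + U (1 Nat.+ #below M A) (#above M A)
      ≡⟨ ≡.cong₂ F (≡.sym (#below-∷< A x<M)) (≡.sym (#above-∷≤ A (ℕ.<⇒≤ x<M))) ⟩
    F (#below M (x ∷ A)) (#above M (x ∷ A)) ∎
    where
    rest-above-x : sumOver (leading M m (x ∷ A)) A ≈ U (1 Nat.+ #below M A) (#above M A)
    rest-above-x = begin
      sumOver (leading M m (x ∷ A)) A
        ≈⟨ sumOver-cong A (λ a a∈A → leading-above-least m len (x<A ∷ sA) (M≢x ∷ M∉A) (here ≡.refl)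
             (All.lookup x<A a∈A) (there a∈A)) ⟩
      sumOver (newMaxTerm M (x ∷ A) 0) A
        ≈⟨ newMaxTerm-tail M 0 x<A ⟩
      sumOver (newMaxTerm M A 1) A
        ≈⟨ sum-new-max 1 A sA M∉A ⟩
      U (1 Nat.+ #below M A) (#above M A) ∎
  ... | tri< M<x _ _ = begin
    sumOver (Φ M) (arrangements (suc m) (x ∷ A))
      ≈⟨ sumOver-prefixes (Φ M) (λ a → arrangements m ((x ∷ A) ─ a)) (x ∷ A) ⟩
    sumOver (leading M m (x ∷ A)) (x ∷ A)
      ≈⟨ sumOver-cong (x ∷ A) (λ a a∈ → trans (leading-new-max m len (x<A ∷ sA) a∈ (M<a a∈))
           (reflexive (≡.sym (newMaxTerm-above (x ∷ A) 0 (M<a a∈))))) ⟩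
    sumOver (newMaxTerm M (x ∷ A) 0) (x ∷ A)
      ≈⟨ sum-new-max 0 (x ∷ A) (x<A ∷ sA) (M≢x ∷ M∉A) ⟩
    U (#below M (x ∷ A)) (#above M (x ∷ A))
      ≡⟨ ≡.cong₂ U below≡ above≡ ⟩
    F 0 (suc (length A))
      ≡⟨ ≡.cong₂ F below≡ above≡ ⟨
    F (#below M (x ∷ A)) (#above M (x ∷ A)) ∎
    where
    M<A : All (M <_) (x ∷ A)
    M<A = M<x ∷ All.map (ℕ.<-trans M<x) x<A
    M<a : ∀ {a} → a ∈ x ∷ A → M < a
    M<a = All.lookup M<A
    below≡ : #below M (x ∷ A) ≡ 0
    below≡ = #below-min M<A
    above≡ : #above M (x ∷ A) ≡ suc (length A)
    above≡ = #above-min M<A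

  I≈F : ∀ n → I R n q t ≈ F 0 n
  I≈F n = begin
    I R n q t
      ≈⟨ sumOver-av321 (weight 0) n ⟩
    sumOver (λ w → when (avoids321 w) (weight 0 w)) (arrangements n (alphabet n))
      ≈⟨ sumOver-cong (arrangements n (alphabet n)) (λ w _ → reflexive
           (≡.cong (λ v → when (avoids321 w) (when (not (has21 v)) (weight 0 w))) (≡.sym (below-zero w)))) ⟩
    sumOver (Φ 0) (arrangements n (alphabet n))
      ≈⟨ scan n (alphabet-length n) (alphabet-sorted n) (All.map ℕ.<⇒≢ (alphabet-positive n)) ⟩
    F (#below 0 (alphabet n)) (#above 0 (alphabet n))
      ≡⟨ ≡.cong₂ F (#below-min (alphabet-positive n)) (≡.trans (#above-min (alphabet-positive n)) (alphabet-length n)) ⟩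
    F 0 n ∎
    where
    below-zero : ∀ w → below 0 w ≡ []
    below-zero w = filter-none (T? ∘ (λ y → y <ᵇ 0)) (All.universal (λ y → ≮⇒¬T {y} z≤n) w)

module Series {c ℓ : Level} (R : CommutativeSemiring c ℓ) (q : CommutativeSemiring.Carrier R) where
  open CommutativeSemiring R hiding (zero)
  open import Algebra.Properties.CommutativeSemigroup +-commutativeSemigroup
    using () renaming (interchange to +-interchange)
  open import Algebra.Properties.CommutativeSemigroup *-commutativeSemigroup using (x∙yz≈y∙xz)

  Σ< : ℕ → (ℕ → Carrier) → Carrier
  Σ< = sumTo R

  Σ<-cong : ∀ N {f g : ℕ → Carrier} → (∀ k → k < N → f k ≈ g k) → Σ< N f ≈ Σ< N g
  Σ<-cong zero    f≈g = refl
  Σ<-cong (suc N) f≈g = +-cong (Σ<-cong N (λ k k<N → f≈g k (ℕ.m<n⇒m<1+n k<N))) (f≈g N (ℕ.n<1+n N))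

  Σ<-zero : ∀ N (f : ℕ → Carrier) → (∀ k → k < N → f k ≈ 0#) → Σ< N f ≈ 0#
  Σ<-zero zero    f f≈0 = refl
  Σ<-zero (suc N) f f≈0 =
    trans (+-cong (Σ<-zero N f (λ k k<N → f≈0 k (ℕ.m<n⇒m<1+n k<N))) (f≈0 N (ℕ.n<1+n N))) (+-identityʳ 0#)

  Σ<-first : ∀ N (f : ℕ → Carrier) → Σ< (suc N) f ≈ f 0 + Σ< N (λ k → f (suc k))
  Σ<-first zero    f = +-comm 0# (f 0)
  Σ<-first (suc N) f = trans (+-cong (Σ<-first N f) refl) (+-assoc _ _ _)

  Σ<-+ : ∀ N (f g : ℕ → Carrier) → Σ< N (λ k → f k + g k) ≈ Σ< N f + Σ< N g
  Σ<-+ zero    f g = sym (+-identityˡ 0#)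
  Σ<-+ (suc N) f g = trans (+-cong (Σ<-+ N f g) refl) (+-interchange _ _ _ _)

  Σ<-*ˡ : ∀ N x (f : ℕ → Carrier) → x * Σ< N f ≈ Σ< N (λ k → x * f k)
  Σ<-*ˡ zero    x f = zeroʳ x
  Σ<-*ˡ (suc N) x f = trans (distribˡ x _ _) (+-cong (Σ<-*ˡ N x f) refl)

  -- Formal power series as coefficient sequences, equal when all coefficients are.
  Seq : Set c
  Seq = ℕ → Carrier

  infix 4 _≋_
  _≋_ : Seq → Seq → Set ℓ
  f ≋ g = ∀ m → f m ≈ g m

  -- The series 1, multiplication by x, the substitution x ↦ q x, sum,
  -- scalar multiple and product.
  δ : Seq
  δ zero    = 1#
  δ (suc m) = 0#

  X : Seq → Seq
  X f zero    = 0#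
  X f (suc m) = f m

  S : Seq → Seq
  S f m = pow R q m * f m

  infixl 6 _⊕_
  _⊕_ : Seq → Seq → Seq
  (f ⊕ g) m = f m + g m

  infixr 7 _·_
  _·_ : Carrier → Seq → Seq
  (x · f) m = x * f m

  infixl 7 _⋆_
  _⋆_ : Seq → Seq → Seq
  (f ⋆ g) m = Σ< (suc m) (λ k → f k * g (m ∸ k))

  S-cong : ∀ {f f′} → f ≋ f′ → S f ≋ S f′
  S-cong f≋f′ m = *-cong refl (f≋f′ m)

  ⋆-congˡ : ∀ {f f′} g → f ≋ f′ → f ⋆ g ≋ f′ ⋆ g
  ⋆-congˡ g f≋f′ m = Σ<-cong (suc m) (λ k _ → *-cong (f≋f′ k) refl)

  X-cong : ∀ {f f′} → f ≋ f′ → X f ≋ X f′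
  X-cong f≋f′ zero    = refl
  X-cong f≋f′ (suc m) = f≋f′ m

  S-⊕ : ∀ f g → S (f ⊕ g) ≋ S f ⊕ S g
  S-⊕ f g m = distribˡ _ _ _

  S-· : ∀ x f → S (x · f) ≋ x · S f
  S-· x f m = x∙yz≈y∙xz _ _ _

  S-X : ∀ f → S (X f) ≋ q · X (S f)
  S-X f zero    = trans (zeroʳ _) (sym (zeroʳ q))
  S-X f (suc m) = *-assoc _ _ _

  S-δ : S δ ≋ δ
  S-δ zero    = *-identityˡ 1#
  S-δ (suc m) = zeroʳ _

  X-⊕ : ∀ f g → X (f ⊕ g) ≋ X f ⊕ X g
  X-⊕ f g zero    = sym (+-identityˡ 0#)
  X-⊕ f g (suc m) = refl

  X-· : ∀ x f → X (x · f) ≋ x · X f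
  X-· x f zero    = sym (zeroʳ x)
  X-· x f (suc m) = refl

  ⋆-⊕ : ∀ f g h → (f ⊕ g) ⋆ h ≋ f ⋆ h ⊕ g ⋆ h
  ⋆-⊕ f g h m = trans (Σ<-cong (suc m) (λ k _ → distribʳ _ _ _)) (Σ<-+ (suc m) _ _)

  ⋆-· : ∀ x f h → (x · f) ⋆ h ≋ x · (f ⋆ h)
  ⋆-· x f h m = trans (Σ<-cong (suc m) (λ k _ → *-assoc _ _ _)) (sym (Σ<-*ˡ (suc m) x _))

  X-⋆ : ∀ f h → X f ⋆ h ≋ X (f ⋆ h)
  X-⋆ f h zero    = trans (+-identityˡ _) (zeroˡ _)
  X-⋆ f h (suc m) = trans (Σ<-first (suc m) _) (trans (+-cong (zeroˡ _) refl) (+-identityˡ _))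

  δ-⋆ : ∀ h → δ ⋆ h ≋ h
  δ-⋆ h m = trans (Σ<-first m _) (trans (+-cong (*-identityˡ _) (Σ<-zero m _ (λ k _ → zeroˡ _))) (+-identityʳ _))

module Recurrence {c ℓ : Level} (R : CommutativeSemiring c ℓ) (q t : CommutativeSemiring.Carrier R) where
  open CommutativeSemiring R hiding (zero)
  open import Relation.Binary.Reasoning.Setoid setoid
  open import Algebra.Solver.Ring.NaturalCoefficients.Default R
  open import Algebra.Properties.CommutativeSemigroup *-commutativeSemigroup using (x∙yz≈y∙xz)
  open Series R q
  open Scan R q t using (F; U)

  -- The sequence defined by the recurrence of the theorem.  Jf f computes it
  -- with recursion depth f, which gives the right value at n once f > n.
  Jf : ℕ → ℕ → Carrier
  Jf zero    n       = 0#
  Jf (suc f) zero    = 1#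
  Jf (suc f) (suc n) = t * Jf f n + Σ< n (λ k → pow R q (suc k) * Jf f k * Jf f (n ∸ k))

  J : Seq
  J n = Jf (suc n) n

  Jf-depth : ∀ f f′ n → n < f → n < f′ → Jf f n ≈ Jf f′ n
  Jf-depth (suc f) (suc f′) zero    _           _            = refl
  Jf-depth (suc f) (suc f′) (suc n) (s≤s n<f) (s≤s n<f′) =
    +-cong (*-cong refl (Jf-depth f f′ n n<f n<f′)) (Σ<-cong n (λ k k<n → *-cong
      (*-cong refl (Jf-depth f f′ k (ℕ.<-trans k<n n<f) (ℕ.<-trans k<n n<f′)))
      (Jf-depth f f′ (n ∸ k) (ℕ.≤-<-trans (ℕ.m∸n≤m n k) n<f) (ℕ.≤-<-trans (ℕ.m∸n≤m n k) n<f′))))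

  J-rec : ∀ m → J (suc m) ≈ t * J m + Σ< m (λ k → pow R q (suc k) * J k * J (m ∸ k))
  J-rec m = +-cong refl (Σ<-cong m (λ k k<m → *-cong
    (*-cong refl (Jf-depth (suc m) (suc k) k (ℕ.m<n⇒m<1+n k<m) (ℕ.n<1+n k)))
    (Jf-depth (suc m) (suc (m ∸ k)) (m ∸ k) (s≤s (ℕ.m∸n≤m m k)) (ℕ.n<1+n (m ∸ k)))))

  -- J without its constant term, and the recurrence in series form:
  -- J - 1 = x (t J + q J(qx) (J - 1)).
  W : Seq
  W zero    = 0#
  W (suc m) = J (suc m)

  J≡W : ∀ {j} → 0 < j → J j ≡ W j
  J≡W {suc j} _ = ≡.refl

  J-series : W ≋ X (t · J ⊕ q · (S J ⋆ W))
  J-series zero    = refl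
  J-series (suc m) = begin
    J (suc m)
      ≈⟨ J-rec m ⟩
    t * J m + Σ< m (λ k → pow R q (suc k) * J k * J (m ∸ k))
      ≈⟨ +-cong refl (Σ<-cong m (λ k k<m → trans
           (*-cong (*-assoc q (pow R q k) (J k)) (reflexive (J≡W (ℕ.m<n⇒0<n∸m k<m))))
           (*-assoc q _ _))) ⟩
    t * J m + Σ< m (λ k → q * (S J k * W (m ∸ k)))
      ≈⟨ +-cong refl (Σ<-*ˡ m q _) ⟨
    t * J m + q * Σ< m (λ k → S J k * W (m ∸ k))
      ≈⟨ +-cong refl (*-cong refl (+-identityʳ _)) ⟨
    t * J m + q * (Σ< m (λ k → S J k * W (m ∸ k)) + 0#)
      ≈⟨ +-cong refl (*-cong refl (+-cong refl (trans
           (*-cong refl (reflexive (≡.cong W (ℕ.n∸n≡0 m)))) (zeroʳ _)))) ⟨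
    t * J m + q * (S J ⋆ W) m ∎

  -- The linear operator f ↦ f(qx) (J - 1), and how it interacts with the
  -- series operations.
  L : Seq → Seq
  L f = S f ⋆ W

  L-cong : ∀ {f f′} → f ≋ f′ → L f ≋ L f′
  L-cong f≋f′ = ⋆-congˡ W (S-cong f≋f′)

  L-⊕ : ∀ f g → L (f ⊕ g) ≋ L f ⊕ L g
  L-⊕ f g m = trans (⋆-congˡ W (S-⊕ f g) m) (⋆-⊕ (S f) (S g) W m)

  L-· : ∀ x f → L (x · f) ≋ x · L f
  L-· x f m = trans (⋆-congˡ W (S-· x f) m) (⋆-· x (S f) W m)

  L-X : ∀ f → L (X f) ≋ q · X (L f)
  L-X f m = trans (⋆-congˡ W (S-X f) m) (trans (⋆-· q (X (S f)) W m) (*-cong refl (X-⋆ (S f) W m)))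

  L-δ : L δ ≋ W
  L-δ m = trans (⋆-congˡ W S-δ m) (δ-⋆ W m)

  -- The explicit solution of the transfer recursion: A (suc i) will be F i,
  -- and q^i L (A i) will be U i.
  A : ℕ → Seq
  A zero    = δ
  A (suc i) = A i ⊕ pow R q i · L (A i)

  -- The series with L (A i) = x · Next i (lemma L-A below).
  Next : ℕ → Seq
  Next i = t · A (suc i) ⊕ q · L (A (suc i))

  -- A 1 = 1 + (J - 1) = J.
  A₁≋J : A 1 ≋ J
  A₁≋J zero    = trans (+-cong refl (trans (*-identityˡ _) (L-δ 0))) (+-identityʳ 1#)
  A₁≋J (suc m) = trans (+-cong refl (trans (*-identityˡ _) (L-δ (suc m)))) (+-identityˡ _)

  Next-suc : ∀ i → Next (suc i) ≋ Next i ⊕ pow R q (suc i) · L (Next i)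
  Next-suc i m = begin
    t * (a + Q * l₁) + q * L (A (suc i) ⊕ Q · L (A (suc i))) m
      ≈⟨ +-cong refl (*-cong refl (trans (L-⊕ (A (suc i)) _ m) (+-cong refl (L-· Q (L (A (suc i))) m)))) ⟩
    t * (a + Q * l₁) + q * (l₁ + Q * l₂)
      ≈⟨ solve 6 (λ t a Q l₁ q l₂ → t :* (a :+ Q :* l₁) :+ q :* (l₁ :+ Q :* l₂)
                                     := (t :* a :+ q :* l₁) :+ Q :* (t :* l₁ :+ q :* l₂)) refl t a Q l₁ q l₂ ⟩
    (t * a + q * l₁) + Q * (t * l₁ + q * l₂)
      ≈⟨ +-cong refl (*-cong refl (trans (L-⊕ (t · A (suc i)) _ m)
           (+-cong (L-· t (A (suc i)) m) (L-· q (L (A (suc i))) m)))) ⟨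
    Next i m + Q * L (Next i) m ∎
    where
    Q a l₁ l₂ : Carrier
    Q  = pow R q (suc i)
    a  = A (suc i) m
    l₁ = L (A (suc i)) m
    l₂ = L (L (A (suc i))) m

  -- By induction on i; the case i = 0 is the recurrence for J in series form.
  L-A : ∀ i → L (A i) ≋ X (Next i)
  L-A zero    m = begin
    L δ m                                 ≈⟨ L-δ m ⟩
    W m                                   ≈⟨ J-series m ⟩
    X (t · J ⊕ q · (S J ⋆ W)) m           ≈⟨ X-cong (λ k → +-cong (*-cong refl (A₁≋J k))
                                                  (*-cong refl (⋆-congˡ W (S-cong A₁≋J) k))) m ⟨
    X (Next 0) m                          ∎
  L-A (suc i) m = begin
    L (A i ⊕ pow R q i · L (A i)) m
      ≈⟨ trans (L-⊕ (A i) _ m) (+-cong refl (L-· (pow R q i) (L (A i)) m)) ⟩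
    L (A i) m + pow R q i * L (L (A i)) m
      ≈⟨ +-cong (L-A i m) (*-cong refl (trans (L-cong (L-A i) m) (L-X (Next i) m))) ⟩
    X (Next i) m + pow R q i * (q * X (L (Next i)) m)
      ≈⟨ +-cong refl (trans (x∙yz≈y∙xz _ _ _) (trans (sym (*-assoc _ _ _)) (sym (X-· (pow R q (suc i)) (L (Next i)) m)))) ⟩
    X (Next i) m + X (pow R q (suc i) · L (Next i)) m
      ≈⟨ X-⊕ (Next i) _ m ⟨
    X (Next i ⊕ pow R q (suc i) · L (Next i)) m
      ≈⟨ X-cong (Next-suc i) m ⟨
    X (Next (suc i)) m ∎

  U≈ : ∀ r i → U i r ≈ pow R q i * L (A i) r
  F≈ : ∀ r i → F i r ≈ A (suc i) r

  U≈ zero    i = sym (trans (*-cong refl (L-A i 0)) (zeroʳ _))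
  U≈ (suc r) i = begin
    pow R q i * t * F i r + U (suc i) r
      ≈⟨ +-cong (*-cong refl (F≈ r i)) (U≈ r (suc i)) ⟩
    pow R q i * t * A (suc i) r + q * pow R q i * L (A (suc i)) r
      ≈⟨ solve 5 (λ Q t a q l → Q :* t :* a :+ q :* Q :* l := Q :* (t :* a :+ q :* l)) refl _ _ _ _ _ ⟩
    pow R q i * Next i r
      ≈⟨ *-cong refl (L-A i (suc r)) ⟨
    pow R q i * L (A i) (suc r) ∎

  F≈ zero    zero    = sym (trans (+-cong refl (trans (*-identityˡ _) (L-δ 0))) (+-identityʳ 1#))
  F≈ (suc r) zero    = trans (U≈ (suc r) 0) (sym (+-identityˡ _))
  F≈ r       (suc i) = +-cong (F≈ r i) (U≈ r (suc i))

  F₀≈J : ∀ n → F 0 n ≈ J n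
  F₀≈J n = trans (F≈ n 0) (A₁≋J n)

theorem1p1 : {c ℓ : Level} (R : CommutativeSemiring c ℓ) →
    let open CommutativeSemiring R in
    (q t : Carrier) (n : ℕ) → 1 ≤ n →
    I R n q t ≈ (t * I R (n ∸ 1) q t
      + sumTo R (n ∸ 1) (λ k → pow R q (suc k) * I R k q t * I R (n ∸ k ∸ 1) q t))
theorem1p1 R q t (suc m) _ = begin
  I R (suc m) q t
    ≈⟨ I≈J (suc m) ⟩
  J (suc m)
    ≈⟨ J-rec m ⟩
  t * J m + Σ< m (λ k → pow R q (suc k) * J k * J (m ∸ k))
    ≈⟨ +-cong (*-cong refl (I≈J m)) (Σ<-cong m (λ k _ → *-cong (*-cong refl (I≈J k))
         (trans (reflexive (≡.cong (λ j → I R j q t) (suc∸suc m k))) (I≈J (m ∸ k))))) ⟨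
  t * I R m q t + sumTo R m (λ k → pow R q (suc k) * I R k q t * I R (suc m ∸ k ∸ 1) q t) ∎
  where
  open CommutativeSemiring R hiding (zero)
  open import Relation.Binary.Reasoning.Setoid setoid
  open Series R q using (Σ<; Σ<-cong)
  open Scan R q t using (I≈F)
  open Recurrence R q t using (J; J-rec; F₀≈J)
  I≈J : ∀ n → I R n q t ≈ J n
  I≈J n = trans (I≈F n) (F₀≈J n)
  suc∸suc : ∀ m k → suc m ∸ k ∸ 1 ≡ m ∸ k
  suc∸suc m k = ≡.trans (ℕ.∸-+-assoc (suc m) k 1) (≡.cong (suc m ∸_) (ℕ.+-comm k 1))
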